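{- Let $\Delta_1,\Delta_2$ be integers with $\Delta_2>\Delta_1\ge1$. Let $\mathcal G$ be a temporal graph such that, for every set $S$ of at most five vertices of $\mathcal G$, the induced temporal subgraph $\mathcal G[S]$ is a $(\Delta_1,\Delta_2)$-cluster temporal graph. Then $\mathcal G$ is a $(\Delta_1,\Delta_2)$-cluster temporal graph.
   Context: A temporal graph $\mathcal G=(G,\mathcal T)$ consists of a finite static undirected graph $G=(V,E)$ and a function $\mathcal T:E\to 2^{\mathbb Z^+}\setminus\{\emptyset\}$ (finite sets); its time-edges are $\mathcal E(\mathcal G)=\{(e,t):e\in E,\ t\in\mathcal T(e)\}$ and its lifetime is $T(\mathcal G)=\max\{t:(e,t)\in\mathcal E(\mathcal G)\}$. An interval $[a,b]$ means $\{a,\dots,b\}\subseteq\mathbb Z$. An edge $e$ is $\Delta_1$-dense in $[a,b]$ if for every $\tau\in[a,\max\{a,b-\Delta_1+1\}]$ there is $t\in\mathcal T(e)$ with $\tau\le t\le\tau+\Delta_1-1$. A template is a pair $(X,[a,b])$ with $X$ a vertex set. Templates $(X,[a,b])$, $(Y,[c,d])$ are $\Delta_2$-independent if $X\cap Y=\emptyset$ or $|s-t|\ge\Delta_2$ for all $s\in[a,b]$, $t\in[c,d]$. $\mathcal G$ realises a collection $\{(X_i,[a_i,b_i])\}_i$ of pairwise $\Delta_2$-independent templates with $1\le a_i\le b_i\le T(\mathcal G)$ if every time-edge $(xy,t)$ has some $i$ with $x,y\in X_i$, $t\in[a_i,b_i]$, and for every $i$ and distinct $x,y\in X_i$, $xy$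 is an edge that is $\Delta_1$-dense in $[a_i,b_i]$; $\mathcal G$ is a $(\Delta_1,\Delta_2)$-cluster temporal graph if it realises some such collection. For $S\subseteq V$, $\mathcal G[S]$ is the temporal graph on vertex set $S$ with the time-edges of $\mathcal G$ having both endpoints in $S$. -}

module Defs where

open import Data.Nat using (ℕ; zero; suc; _+_; _∸_; _≤_; _<_; _⊔_; ∣_-_∣)
open import Data.Fin using (Fin)
open import Data.Fin.Subset using (Subset; _∈_)
open import Data.List using (List; [])
open import Data.List.Membership.Propositional using () renaming (_∈_ to _∈ₗ_)
open import Data.Product using (Σ; ∃; ∃-syntax; _×_)
open import Data.Sum using (_⊎_)
open import Function.Definitions using (Injective)
open import Relation.Binary.PropositionalEquality using (_≡_; _≢_)
open import Relation.Nullary using (¬_)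

-- A temporal graph on the finite vertex set Fin n.
-- times x y is a finite list of time labels of the pair {x,y}; the static
-- edge xy exists iff times x y is nonempty, and then 𝒯(xy) is the set of
-- elements of times x y (so 𝒯(xy) is a nonempty finite set of positive ints).
record TemporalGraph : Set where
  field
    n      : ℕ
    times  : Fin n → Fin n → List ℕ
    symm   : ∀ x y t → t ∈ₗ times x y → t ∈ₗ times y x
    noLoop : ∀ x → times x x ≡ []
    pos    : ∀ x y t → t ∈ₗ times x y → 1 ≤ t
open TemporalGraph public

TimeEdge : (𝒢 : TemporalGraph) → Fin (n 𝒢) → Fin (n 𝒢) → ℕ → Set
TimeEdge 𝒢 x y t = t ∈ₗ times 𝒢 x y

IsEdge : (𝒢 : TemporalGraph) → Fin (n 𝒢) → Fin (n 𝒢) → Set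
IsEdge 𝒢 x y = ¬ (times 𝒢 x y ≡ [])

-- b ≤ T(𝒢), where T(𝒢) is the maximum time of a time-edge
-- (literally: some time-edge has time ≥ b)
≤Lifetime : (𝒢 : TemporalGraph) → ℕ → Set
≤Lifetime 𝒢 b = ∃[ x ] ∃[ y ] ∃[ t ] (TimeEdge 𝒢 x y t × b ≤ t)

_∈[_,_] : ℕ → ℕ → ℕ → Set
t ∈[ a , b ] = a ≤ t × t ≤ b

Dense : (𝒢 : TemporalGraph) → ℕ → Fin (n 𝒢) → Fin (n 𝒢) → ℕ → ℕ → Set
Dense 𝒢 Δ₁ x y a b =
  ∀ τ → τ ∈[ a , a ⊔ (b + 1 ∸ Δ₁) ] →
    ∃[ t ] (TimeEdge 𝒢 x y t × t ∈[ τ , τ + Δ₁ ∸ 1 ])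

record Template (m : ℕ) : Set where
  constructor template
  field
    X : Subset m
    a : ℕ
    b : ℕ
open Template public

Independent : {m : ℕ} → ℕ → Template m → Template m → Set
Independent Δ₂ T₁ T₂ =
  (∀ v → ¬ (v ∈ X T₁ × v ∈ X T₂))
  ⊎ (∀ s t → s ∈[ a T₁ , b T₁ ] → t ∈[ a T₂ , b T₂ ] → Δ₂ ≤ ∣ s - t ∣)

Realises : (Δ₁ Δ₂ : ℕ) (𝒢 : TemporalGraph) (k : ℕ) → (Fin k → Template (n 𝒢)) → Set
Realises Δ₁ Δ₂ 𝒢 k 𝒯s =
  (∀ i j → i ≢ j → Independent Δ₂ (𝒯s i) (𝒯s j))
  × (∀ i → 1 ≤ a (𝒯s i) × a (𝒯s i) ≤ b (𝒯s i) × ≤Lifetime 𝒢 (b (𝒯s i)))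
  × (∀ x y t → TimeEdge 𝒢 x y t →
       ∃[ i ] (x ∈ X (𝒯s i) × y ∈ X (𝒯s i) × t ∈[ a (𝒯s i) , b (𝒯s i) ]))
  × (∀ i x y → x ∈ X (𝒯s i) → y ∈ X (𝒯s i) → x ≢ y →
       IsEdge 𝒢 x y × Dense 𝒢 Δ₁ x y (a (𝒯s i)) (b (𝒯s i)))

IsCluster : (Δ₁ Δ₂ : ℕ) → TemporalGraph → Set
IsCluster Δ₁ Δ₂ 𝒢 = ∃[ k ] Σ (Fin k → Template (n 𝒢)) (Realises Δ₁ Δ₂ 𝒢 k)

-- induced temporal subgraph 𝒢[S], where S (with |S| = m) is given as the
-- image of an injective map f : Fin m → V
induced : (𝒢 : TemporalGraph) {m : ℕ} (f : Fin m → Fin (n 𝒢)) → Injective _≡_ _≡_ f → TemporalGraph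
induced 𝒢 {m} f inj = record
  { n      = m
  ; times  = λ i j → times 𝒢 (f i) (f j)
  ; symm   = λ i j t → symm 𝒢 (f i) (f j) t
  ; noLoop = λ i → noLoop 𝒢 (f i)
  ; pos    = λ i j t → pos 𝒢 (f i) (f j) t
  }

-- Anchor a candidate template at each time-edge of x at time t: its vertices are x and every z with
-- an xz-time-edge within Δ₂ of t, and its uv-time-edges are those reachable from one within Δ₂ of t
-- by steps of length at most Δ₁. Each property of a candidate involves at most five vertices, and in
-- a realisation of the subgraph induced on them the candidate is exactly the template containing the
-- anchor, since Δ₂-independence forbids two templates through one vertex at nearby times. Hence all
-- time-edges of a candidate anchor the same candidate, distinct candidates are Δ₂-independent, and
-- the candidates realise 𝒢.
module Submission where

open import Defs
open import Data.Bool using () renaming (_≟_ to _≟ᵇ_)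
open import Data.Bool.Properties using (T-≡)
open import Data.Empty using (⊥-elim)
open import Data.Fin using (Fin) renaming (_≟_ to _≟ᶠ_)
import Data.Fin as Fin
open import Data.Fin.Properties using (any?)
open import Data.Fin.Subset using (Subset; _∈_)
open import Data.Fin.Subset.Properties using (_∈?_)
open import Data.List using (List; []; _∷_; _++_; length; map; concatMap; filter; allFin; deduplicate; lookup)
open import Data.List.Extrema.Nat using (min; max; min≤⊤; ⊥≤max; min≤xs; xs≤max; argmin-all; argmax-all)
open import Data.List.Membership.Propositional using (find; lose) renaming (_∈_ to _∈ₗ_)
open import Data.List.Membership.Propositional.Properties
  using (∈-map⁺; ∈-map⁻; ∈-concatMap⁺; ∈-concatMap⁻; ∈-filter⁺; ∈-filter⁻; ∈-allFin;
         ∈-lookup; ∈-deduplicate⁺; ∈-deduplicate⁻; ∈-++⁺ˡ; ∈-++⁺ʳ)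
open import Data.List.Properties using (length-++; length-deduplicate)
open import Data.List.Relation.Unary.All as All using (All)
open import Data.List.Relation.Unary.AllPairs using (_∷_)
open import Data.List.Relation.Unary.Any as Any using (here; there)
open import Data.List.Relation.Unary.Any.Properties using (lookup-index)
open import Data.List.Relation.Unary.Unique.Propositional using (Unique)
open import Data.List.Relation.Unary.Unique.DecPropositional.Properties using (deduplicate-!)
open import Data.Nat
  using (ℕ; zero; suc; _+_; _∸_; _≤_; _<_; _⊔_; _⊓_; ∣_-_∣; z≤n; s≤s; _≤?_; _<?_; _≟_; allUpTo?; >-nonZero)
open import Data.Nat.Properties
open import Data.List.Membership.DecPropositional _≟_ using () renaming (_∈?_ to _∈ₗ?_)
open import Data.Product using (∃; ∃-syntax; _×_; _,_; proj₁; proj₂)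
open import Data.Sum using (_⊎_; inj₁; inj₂)
open import Data.Vec using (tabulate)
open import Data.Vec.Properties using (≡-dec; lookup⇒[]=; []=⇒lookup; lookup∘tabulate; tabulate-cong)
open import Function.Base using (case_of_)
open import Function.Bundles using (_⇔_; mk⇔; Equivalence)
open import Function.Definitions using (Injective)
import Function.Properties.Equivalence as ⇔
open import Relation.Binary.PropositionalEquality using (_≡_; _≢_; refl; sym; trans; cong; subst; subst₂)
open import Relation.Nullary using (Dec; yes; no; does)
open import Relation.Nullary.Decidable using (map′; toWitness; dec-true; isYes≗does; does-⇔; _×-dec_; _⊎-dec_; _→-dec_)

open Equivalence using (to; from)

lookup-injective : ∀ {A : Set} {xs : List A} → Unique xs → ∀ i j → lookup xs i ≡ lookup xs j → i ≡ j
lookup-injective (_   ∷ _)  Fin.zero    Fin.zero    _  = refl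
lookup-injective (x∉ ∷ _)  Fin.zero    (Fin.suc j) eq = ⊥-elim (All.lookup x∉ (∈-lookup j) eq)
lookup-injective (x∉ ∷ _)  (Fin.suc i) Fin.zero    eq = ⊥-elim (All.lookup x∉ (∈-lookup i) (sym eq))
lookup-injective (_  ∷ xs!) (Fin.suc i) (Fin.suc j) eq = cong Fin.suc (lookup-injective xs! i j eq)

∃∈? : ∀ {P : ℕ → Set} → (∀ r → Dec (P r)) → (xs : List ℕ) → Dec (∃[ r ] (r ∈ₗ xs × P r))
∃∈? P? xs = map′ find (λ (r , r∈ , pr) → lose r∈ pr) (Any.any? P? xs)

_≟ᵀ_ : ∀ {m} (T T' : Template m) → Dec (T ≡ T')
template X a b ≟ᵀ template X' a' b' =
  map′ (λ { (refl , refl , refl) → refl }) (λ { refl → refl , refl , refl }) (≡-dec _≟ᵇ_ X X' ×-dec a ≟ a' ×-dec b ≟ b')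

-- Δ₁ is written suc e throughout, so that the windows [τ, τ + Δ₁ - 1] of the density
-- condition need no truncated subtraction.
module _ (e Δ₂ : ℕ) (1+e<Δ₂ : suc e < Δ₂) where

  Near : ℕ → ℕ → Set
  Near s t = s < t + Δ₂ × t < s + Δ₂

  Close : ℕ → ℕ → Set
  Close s t = s ≤ t + e × t ≤ s + e

  private
    e<Δ₂ : e < Δ₂
    e<Δ₂ = <-trans (n<1+n e) 1+e<Δ₂

    0<Δ₂ : 0 < Δ₂
    0<Δ₂ = ≤-<-trans z≤n e<Δ₂

  Near? : ∀ s t → Dec (Near s t)
  Near? s t = (s <? t + Δ₂) ×-dec (t <? s + Δ₂)

  near-refl : ∀ s → Near s s
  near-refl s = m<m+n s 0<Δ₂ , m<m+n s 0<Δ₂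

  near-sym : ∀ {s t} → Near s t → Near t s
  near-sym (s<t+Δ , t<s+Δ) = t<s+Δ , s<t+Δ

  close⇒near : ∀ {s t} → Close s t → Near s t
  close⇒near (s≤t+e , t≤s+e) = ≤-<-trans s≤t+e (+-monoʳ-< _ e<Δ₂) , ≤-<-trans t≤s+e (+-monoʳ-< _ e<Δ₂)

  near⇒dist< : ∀ {s t} → Near s t → ∣ s - t ∣ < Δ₂
  near⇒dist< {s} {t} (s<t+Δ , t<s+Δ) with ≤-total s t
  ... | inj₁ s≤t = subst (_< Δ₂) (sym (m≤n⇒∣m-n∣≡n∸m s≤t)) (m<n+o⇒m∸n<o t s {{>-nonZero 0<Δ₂}} t<s+Δ)
  ... | inj₂ t≤s = subst (_< Δ₂) (sym (m≤n⇒∣n-m∣≡n∸m t≤s)) (m<n+o⇒m∸n<o s t {{>-nonZero 0<Δ₂}} s<t+Δ)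

  dist<⇒near : ∀ {s t} → ∣ s - t ∣ < Δ₂ → Near s t
  dist<⇒near {s} {t} d<Δ = ≤-<-trans (m≤n+∣m-n∣ s t) (+-monoʳ-< t d<Δ) , ≤-<-trans (m≤n+∣n-m∣ t s) (+-monoʳ-< s d<Δ)

  WindowDense : (ℕ → Set) → ℕ → ℕ → Set
  WindowDense P a b = ∀ τ → a ≤ τ → τ ≤ a ⊔ (b ∸ e) → ∃[ r ] (P r × τ ≤ r × r ≤ τ + e)

  -- Query the window starting at τ, pushed back to the last admissible window if τ is beyond it.
  windowDense⇒close : ∀ {P a b τ} → WindowDense P a b → a ≤ τ → τ ≤ b → ∃[ r ] (P r × Close r τ)
  windowDense⇒close {P} {a} {b} {τ} dense a≤τ τ≤b
    with dense (τ ⊓ (a ⊔ (b ∸ e))) (⊓-glb a≤τ (m≤m⊔n a (b ∸ e))) (m⊓n≤n τ _)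
  ... | r , pr , σ≤r , r≤σ+e = r , pr , ≤-trans r≤σ+e (+-monoˡ-≤ e (m⊓n≤m τ _)) , τ≤r+e
    where
      τ≤r+e : τ ≤ r + e
      τ≤r+e with ⊓-sel τ (a ⊔ (b ∸ e))
      ... | inj₁ σ≡τ = m≤n⇒m≤n+o e (subst (_≤ r) σ≡τ σ≤r)
      ... | inj₂ σ≡end = begin
        τ           ≤⟨ τ≤b ⟩
        b           ≤⟨ m≤n+m∸n b e ⟩
        e + (b ∸ e) ≡⟨ +-comm e (b ∸ e) ⟩
        b ∸ e + e   ≤⟨ +-monoˡ-≤ e (≤-trans (m≤n⊔m a (b ∸ e)) (subst (_≤ r) σ≡end σ≤r)) ⟩
        r + e       ∎
        where open ≤-Reasoning

  record Span (P : ℕ → Set) (α β : ℕ) : Set where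
    field
      bounds  : ∀ {r} → P r → r ∈[ α , β ]
      windows : ∀ τ → α ≤ τ → τ ≤ β ∸ e → ∃[ r ] (P r × τ ≤ r × r ≤ τ + e)

  -- Locate the P-points relative to the window [τ, τ + e]: one beyond it puts the window inside the
  -- start span, one before it puts it inside the end span (or forces τ ≤ a), and otherwise the window
  -- contains every P-point.
  spans⇒windowDense : ∀ {P a b α β α' β'} → (∀ r → Dec (P r)) → ∃ P → (∀ {r} → P r → a ≤ r) →
                      Span P α β → α ≤ a → Span P α' β' → b ≤ β' → WindowDense P a b
  spans⇒windowDense {P} {a} {b} {α} {β} {α'} {β'} P? (r₀ , pr₀) a≤P startSpan α≤a endSpan b≤β' τ a≤τ τ≤a⊔[b∸e]
    with anyUpTo? (λ r → P? r ×-dec (τ + e ≤? r)) (suc β)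
  ... | yes (r , _ , pr , τ+e≤r) =
    Span.windows startSpan τ (≤-trans α≤a a≤τ) (m+n≤o⇒m≤o∸n τ (≤-trans τ+e≤r (proj₂ (Span.bounds startSpan pr))))
  ... | no none-after with anyUpTo? (λ r → P? r ×-dec (r ≤? τ)) (suc τ)
  ...   | no none-before =
    r₀ , pr₀ , <⇒≤ (≰⇒> (λ r₀≤τ → none-before (r₀ , s≤s r₀≤τ , pr₀ , r₀≤τ))) ,
    <⇒≤ (≰⇒> (λ τ+e≤r₀ → none-after (r₀ , s≤s (proj₂ (Span.bounds startSpan pr₀)) , pr₀ , τ+e≤r₀)))
  ...   | yes (r , _ , pr , r≤τ) with τ ≤? b ∸ e
  ...     | yes τ≤b∸e =
    Span.windows endSpan τ (≤-trans (proj₁ (Span.bounds endSpan pr)) r≤τ) (≤-trans τ≤b∸e (∸-monoˡ-≤ e b≤β'))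
  ...     | no τ≰b∸e = r , pr , ≤-trans τ≤a (a≤P pr) , m≤n⇒m≤n+o e r≤τ
    where
      τ≤a : τ ≤ a
      τ≤a with ⊔-sel a (b ∸ e)
      ... | inj₁ a⊔≡a   = subst (τ ≤_) a⊔≡a τ≤a⊔[b∸e]
      ... | inj₂ a⊔≡b∸e = ⊥-elim (τ≰b∸e (subst (τ ≤_) a⊔≡b∸e τ≤a⊔[b∸e]))

  module _ (𝒢 : TemporalGraph) where

    private
      V : Set
      V = Fin (n 𝒢)

      TE : V → V → ℕ → Set
      TE = TimeEdge 𝒢

    TE-sym : ∀ {u v s} → TE u v s → TE v u s
    TE-sym {u} {v} {s} = symm 𝒢 u v s

    TE⇒≢ : ∀ {u v s} → TE u v s → u ≢ v
    TE⇒≢ {u} {s = s} h refl with subst (s ∈ₗ_) (noLoop 𝒢 u) h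
    ... | ()

    TE? : ∀ u v s → Dec (TE u v s)
    TE? u v s = s ∈ₗ? times 𝒢 u v

    GapFreeOn : V → V → ℕ → ℕ → Set
    GapFreeOn u v a b = ∀ τ → a ≤ τ → τ + suc e ≤ b → ∃[ r ] (TE u v r × τ < r × r ≤ τ + suc e)

    GapFree : V → V → ℕ → ℕ → Set
    GapFree u v s s' = GapFreeOn u v (s ⊓ s') (s ⊔ s')

    gapFree-refl : ∀ {u v} s → GapFree u v s s
    gapFree-refl s τ s⊓s≤τ τ+1+e≤s⊔s = ⊥-elim (<⇒≱ (m<m+n τ (s≤s z≤n)) (begin
      τ + suc e ≤⟨ τ+1+e≤s⊔s ⟩
      s ⊔ s     ≡⟨ ⊔-idem s ⟩
      s         ≡⟨ ⊓-idem s ⟨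
      s ⊓ s     ≤⟨ s⊓s≤τ ⟩
      τ         ∎))
      where open ≤-Reasoning

    gapFree-sym : ∀ {u v s s'} → GapFree u v s s' → GapFree v u s s'
    gapFree-sym gf τ p q with gf τ p q
    ... | r , h , τ<r , r≤ = r , TE-sym h , τ<r , r≤

    -- The templates of a realisation of 𝒢[S], read on the vertices of 𝒢 (see realisation⇒localCluster).
    record LocalCluster (S : V → Set) : Set₁ where
      field
        size      : ℕ
        Member    : Fin size → V → Set
        start end : Fin size → ℕ
        covers    : ∀ u v s → S u → S v → TE u v s →
                    ∃[ i ] (Member i u × Member i v × s ∈[ start i , end i ])
        separated : ∀ i j → i ≢ j → ∀ w → Member i w → Member j w →
                    ∀ s t → s ∈[ start i , end i ] → t ∈[ start j , end j ] → Δ₂ ≤ ∣ s - t ∣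
        dense     : ∀ i u v → Member i u → Member i v → u ≢ v → WindowDense (TE u v) (start i) (end i)

      InSpan : Fin size → ℕ → Set
      InSpan i s = s ∈[ start i , end i ]

    -- VertexOf x t and EdgeOf x t describe the candidate template anchored at a time-edge of x at time t.
    NearEdge : V → V → ℕ → Set
    NearEdge x z t = ∃[ r ] (TE x z r × Near r t)

    VertexOf : V → ℕ → V → Set
    VertexOf x t z = z ≡ x ⊎ NearEdge x z t

    Linked : V → V → ℕ → ℕ → Set
    Linked u v t s = ∃[ s' ] (TE u v s' × Near s' t × GapFree u v s' s)

    record EdgeOf (x : V) (t : ℕ) (u v : V) (s : ℕ) : Set where
      constructor edgeOf
      field
        left     : VertexOf x t u
        right    : VertexOf x t v
        timeEdge : TE u v s
        linked   : Linked u v t s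

    open EdgeOf

    edgeOf-sym : ∀ {x t u v s} → EdgeOf x t u v s → EdgeOf x t v u s
    edgeOf-sym (edgeOf u∈ v∈ h (s' , h' , s'~t , gf)) = edgeOf v∈ u∈ (TE-sym h) (s' , TE-sym h' , s'~t , gapFree-sym gf)

    edgeOf-anchor : ∀ {x v s t} → TE x v s → Near s t → EdgeOf x t x v s
    edgeOf-anchor h s~t = edgeOf (inj₁ refl) (inj₂ (_ , h , s~t)) h (_ , h , s~t , gapFree-refl _)

    record SameTemplate (x : V) (t : ℕ) (x' : V) (t' : ℕ) : Set where
      field
        vertices : ∀ z → VertexOf x t z ⇔ VertexOf x' t' z
        edges    : ∀ u v s → EdgeOf x t u v s ⇔ EdgeOf x' t' u v s

    open SameTemplate

    sameTemplate-sym : ∀ {x t x' t'} → SameTemplate x t x' t' → SameTemplate x' t' x t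
    sameTemplate-sym E = record { vertices = λ z → ⇔.sym (vertices E z) ; edges = λ u v s → ⇔.sym (edges E u v s) }

    sameTemplate-trans : ∀ {x t x' t' x'' t''} → SameTemplate x t x' t' → SameTemplate x' t' x'' t'' → SameTemplate x t x'' t''
    sameTemplate-trans E F = record
      { vertices = λ z → ⇔.trans (vertices E z) (vertices F z)
      ; edges    = λ u v s → ⇔.trans (edges E u v s) (edges F u v s)
      }

    module Local {S : V → Set} (C : LocalCluster S) where
      open LocalCluster C

      template-unique : ∀ {i j w s t} → Member i w → Member j w → InSpan i s → InSpan j t → Near s t → i ≡ j
      template-unique {i} {j} {w} {s} {t} w∈i w∈j s∈i t∈j s~t with i ≟ᶠ j
      ... | yes i≡j = i≡j
      ... | no i≢j  = ⊥-elim (<⇒≱ (near⇒dist< s~t) (separated i j i≢j w w∈i w∈j s t s∈i t∈j))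

      inSpan-near : ∀ {i u v r τ} → S u → S v → Member i u → TE u v r → InSpan i τ → Near r τ → InSpan i r
      inSpan-near su sv u∈i h τ∈i r~τ with covers _ _ _ su sv h
      ... | j , u∈j , _ , r∈j with template-unique u∈i u∈j τ∈i r∈j (near-sym r~τ)
      ... | refl = r∈j

      window-inSpan : ∀ {i u v τ} → S u → S v → Member i u → Member i v → u ≢ v →
                      start i ≤ τ → τ ≤ end i ∸ e → ∃[ r ] (TE u v r × InSpan i r × τ ≤ r × r ≤ τ + e)
      window-inSpan {i} {u} {v} {τ} su sv u∈i v∈i u≢v a≤τ τ≤b∸e
        with dense i u v u∈i v∈i u≢v τ a≤τ (≤-trans τ≤b∸e (m≤n⊔m _ _))
      ... | r , h , τ≤r , r≤τ+e =
        r , h , inSpan-near su sv u∈i h (a≤τ , ≤-trans τ≤b∸e (m∸n≤m _ e)) (close⇒near (r≤τ+e , m≤n⇒m≤n+o e τ≤r)) , τ≤r , r≤τ+e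

      close-inSpan : ∀ {i u v τ} → S u → S v → Member i u → Member i v → u ≢ v → InSpan i τ →
                     ∃[ r ] (TE u v r × InSpan i r × Close r τ)
      close-inSpan su sv u∈i v∈i u≢v τ∈i@(a≤τ , τ≤b) with windowDense⇒close (dense _ _ _ u∈i v∈i u≢v) a≤τ τ≤b
      ... | r , h , r≈τ = r , h , inSpan-near su sv u∈i h τ∈i (close⇒near r≈τ) , r≈τ

      inSpan⇒gapFree : ∀ {i u v s s'} → Member i u → Member i v → u ≢ v → InSpan i s → InSpan i s' → GapFree u v s s'
      inSpan⇒gapFree {i} {u} {v} {s} {s'} u∈i v∈i u≢v (a≤s , s≤b) (a≤s' , s'≤b) τ s⊓s'≤τ τ+1+e≤s⊔s'
        with dense i u v u∈i v∈i u≢v (suc τ) (≤-trans (⊓-glb a≤s a≤s') (≤-trans s⊓s'≤τ (n≤1+n τ)))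
               (≤-trans (m+n≤o⇒m≤o∸n (suc τ) (≤-trans (≤-reflexive (sym (+-suc τ e))) (≤-trans τ+1+e≤s⊔s' (⊔-lub s≤b s'≤b))))
                        (m≤n⊔m _ _))
      ... | r , h , τ<r , r≤ = r , h , τ<r , ≤-trans r≤ (≤-reflexive (sym (+-suc τ e)))

      -- Walk from s towards s' along the gap-free uv-times; each step is shorter than Δ₂.
      gapFreeOn-inSpan : ∀ fuel {i u v s s'} → S u → S v → Member i u → TE u v s' → s ≤ s' → s' ≤ s + fuel →
                         GapFreeOn u v s s' → InSpan i s → InSpan i s'
      gapFreeOn-inSpan fuel {i} {u} {v} {s} {s'} su sv u∈i h' s≤s' s'≤s+fuel gf s∈i with s' ≤? s + suc e
      ... | yes s'≤s+1+e =
        inSpan-near su sv u∈i h' s∈i (≤-<-trans s'≤s+1+e (+-monoʳ-< s 1+e<Δ₂) , ≤-<-trans s≤s' (m<m+n s' 0<Δ₂))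
      gapFreeOn-inSpan zero su sv u∈i h' s≤s' s'≤s+0 gf s∈i | no s'≰ =
        ⊥-elim (s'≰ (m≤n⇒m≤n+o (suc e) (subst (_ ≤_) (+-identityʳ _) s'≤s+0)))
      gapFreeOn-inSpan (suc fuel) {s = s} su sv u∈i h' s≤s' s'≤s+fuel gf s∈i | no s'≰
        with gf s ≤-refl (<⇒≤ (≰⇒> s'≰))
      ... | r , h , s<r , r≤s+1+e =
        gapFreeOn-inSpan fuel su sv u∈i h' (≤-trans r≤s+1+e (<⇒≤ (≰⇒> s'≰)))
          (≤-trans s'≤s+fuel (≤-trans (≤-reflexive (+-suc s fuel)) (+-monoˡ-≤ fuel s<r)))
          (λ τ r≤τ → gf τ (≤-trans (<⇒≤ s<r) r≤τ))
          (inSpan-near su sv u∈i h s∈i (≤-<-trans r≤s+1+e (+-monoʳ-< s 1+e<Δ₂) , ≤-<-trans (<⇒≤ s<r) (m<m+n r 0<Δ₂)))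

      gapFree-inSpan : ∀ {i u v s s'} → S u → S v → Member i u → TE u v s → TE u v s' →
                       InSpan i s → GapFree u v s s' → InSpan i s'
      gapFree-inSpan {i} {u} {v} {s} {s'} su sv u∈i h h' s∈i gf with ≤-total s s'
      ... | inj₁ s≤s' = gapFreeOn-inSpan s' su sv u∈i h' s≤s' (m≤n+m s' s)
                          (subst₂ (GapFreeOn u v) (m≤n⇒m⊓n≡m s≤s') (m≤n⇒m⊔n≡n s≤s') gf) s∈i
      ... | inj₂ s'≤s with covers u v s' su sv h'
      ... | j , u∈j , _ , s'∈j with template-unique u∈i u∈j s∈i
              (gapFreeOn-inSpan s su sv u∈j h s'≤s (m≤n+m s s')
                 (subst₂ (GapFreeOn u v) (m≥n⇒m⊓n≡n s'≤s) (m≥n⇒m⊔n≡m s'≤s) gf) s'∈j)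
              (near-refl s)
      ... | refl = s'∈j

      vertexOf⇔member : ∀ {i x t z} → S x → S z → Member i x → InSpan i t → VertexOf x t z ⇔ Member i z
      vertexOf⇔member {i} {x} {t} {z} sx sz x∈i t∈i = mk⇔ ⇒ ⇐
        where
          ⇒ : VertexOf x t z → Member i z
          ⇒ (inj₁ refl) = x∈i
          ⇒ (inj₂ (r , h , r~t)) with covers x z r sx sz h
          ... | j , x∈j , z∈j , r∈j with template-unique x∈i x∈j t∈i r∈j (near-sym r~t)
          ... | refl = z∈j
          ⇐ : Member i z → VertexOf x t z
          ⇐ z∈i with z ≟ᶠ x
          ... | yes z≡x = inj₁ z≡x
          ... | no z≢x with close-inSpan sx sz x∈i z∈i (λ x≡z → z≢x (sym x≡z)) t∈i
          ... | r , h , _ , r≈t = inj₂ (r , h , close⇒near r≈t)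

      edgeOf⇔member : ∀ {i x t u v s} → S x → S u → S v → Member i x → InSpan i t →
                      EdgeOf x t u v s ⇔ (Member i u × Member i v × TE u v s × InSpan i s)
      edgeOf⇔member {i} {x} {t} {u} {v} {s} sx su sv x∈i t∈i = mk⇔ ⇒ ⇐
        where
          ⇒ : EdgeOf x t u v s → Member i u × Member i v × TE u v s × InSpan i s
          ⇒ (edgeOf u∈ v∈ h (s' , h' , s'~t , gf)) =
            let u∈i = to (vertexOf⇔member sx su x∈i t∈i) u∈
            in u∈i , to (vertexOf⇔member sx sv x∈i t∈i) v∈ , h ,
               gapFree-inSpan su sv u∈i h' h (inSpan-near su sv u∈i h' t∈i s'~t) gf
          ⇐ : Member i u × Member i v × TE u v s × InSpan i s → EdgeOf x t u v s
          ⇐ (u∈i , v∈i , h , s∈i) with close-inSpan su sv u∈i v∈i (TE⇒≢ h) t∈i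
          ... | s' , h' , s'∈i , s'≈t =
            edgeOf (from (vertexOf⇔member sx su x∈i t∈i) u∈i) (from (vertexOf⇔member sx sv x∈i t∈i) v∈i) h
                   (s' , h' , close⇒near s'≈t , inSpan⇒gapFree u∈i v∈i (TE⇒≢ h) s'∈i s∈i)

    dense⇔windowDense : ∀ {u v a b} → Dense 𝒢 (suc e) u v a b ⇔ WindowDense (TE u v) a b
    dense⇔windowDense {u} {v} {a} {b} = mk⇔ ⇒ ⇐
      where
        last-window-start : b + 1 ∸ suc e ≡ b ∸ e
        last-window-start = cong (_∸ suc e) (+-comm b 1)
        window-end : ∀ τ → τ + suc e ∸ 1 ≡ τ + e
        window-end τ = cong (_∸ 1) (+-suc τ e)

        ⇒ : Dense 𝒢 (suc e) u v a b → WindowDense (TE u v) a b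
        ⇒ dense τ a≤τ τ≤ with dense τ (a≤τ , subst (λ c → τ ≤ a ⊔ c) (sym last-window-start) τ≤)
        ... | r , h , τ≤r , r≤ = r , h , τ≤r , subst (r ≤_) (window-end τ) r≤

        ⇐ : WindowDense (TE u v) a b → Dense 𝒢 (suc e) u v a b
        ⇐ dense τ (a≤τ , τ≤) with dense τ a≤τ (subst (λ c → τ ≤ a ⊔ c) last-window-start τ≤)
        ... | r , h , τ≤r , r≤ = r , h , τ≤r , subst (r ≤_) (sym (window-end τ)) r≤

    realisation⇒localCluster : ∀ {m} {f : Fin m → V} (inj : Injective _≡_ _≡_ f) {S : V → Set} →
                               (∀ {u} → S u → ∃[ j ] (f j ≡ u)) →
                               IsCluster (suc e) Δ₂ (induced 𝒢 f inj) → LocalCluster S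
    realisation⇒localCluster {m} {f} inj {S} S⊆f (k , Ts , independent , _ , covered , dense) = record
      { size      = k
      ; Member    = Member
      ; start     = λ i → a (Ts i)
      ; end       = λ i → b (Ts i)
      ; covers    = covers
      ; separated = separated
      ; dense     = λ { i _ _ (j , refl , j∈) (j' , refl , j'∈) fj≢fj' →
                        to dense⇔windowDense (proj₂ (dense i j j' j∈ j'∈ (λ j≡j' → fj≢fj' (cong f j≡j')))) }
      }
      where
        Member : Fin k → V → Set
        Member i v = ∃[ j ] (f j ≡ v × j ∈ X (Ts i))

        covers : ∀ u v s → S u → S v → TE u v s → ∃[ i ] (Member i u × Member i v × s ∈[ a (Ts i) , b (Ts i) ])
        covers u v s su sv h with S⊆f su | S⊆f sv
        ... | j , refl | j' , refl =
          let (i , j∈ , j'∈ , s∈) = covered j j' s h in i , (j , refl , j∈) , (j' , refl , j'∈) , s∈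

        separated : ∀ i i' → i ≢ i' → ∀ w → Member i w → Member i' w →
                    ∀ s t → s ∈[ a (Ts i) , b (Ts i) ] → t ∈[ a (Ts i') , b (Ts i') ] → Δ₂ ≤ ∣ s - t ∣
        separated i i' i≢i' w (j , fj≡w , j∈) (j' , fj'≡w , j'∈) with independent i i' i≢i'
        ... | inj₁ disjoint = ⊥-elim (disjoint j (j∈ , subst (_∈ X (Ts i')) (inj (trans fj'≡w (sym fj≡w))) j'∈))
        ... | inj₂ far      = far

    LocallyCluster : Set
    LocallyCluster =
      ∀ (m : ℕ) → m ≤ 5 → (f : Fin m → V) → (inj : Injective _≡_ _≡_ f) → IsCluster (suc e) Δ₂ (induced 𝒢 f inj)

    localCluster : LocallyCluster → (L : List V) → length L ≤ 5 → LocalCluster (_∈ₗ L)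
    localCluster H L |L|≤5 =
      realisation⇒localCluster inj L⊆U (H (length U) (≤-trans (length-deduplicate _≟ᶠ_ L) |L|≤5) (lookup U) inj)
      where
        U : List V
        U = deduplicate _≟ᶠ_ L
        inj : Injective _≡_ _≡_ (lookup U)
        inj {i} {j} = lookup-injective (deduplicate-! _≟ᶠ_ L) i j
        L⊆U : ∀ {u} → u ∈ₗ L → ∃[ j ] (lookup U j ≡ u)
        L⊆U u∈L = let u∈U = ∈-deduplicate⁺ _≟ᶠ_ u∈L in Any.index u∈U , sym (lookup-index u∈U)

    NearEdge? : ∀ x z t → Dec (NearEdge x z t)
    NearEdge? x z t = ∃∈? (λ r → Near? r t) (times 𝒢 x z)

    VertexOf? : ∀ x t z → Dec (VertexOf x t z)
    VertexOf? x t z = (z ≟ᶠ x) ⊎-dec NearEdge? x z t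

    GapFreeOn? : ∀ u v a b → Dec (GapFreeOn u v a b)
    GapFreeOn? u v a b =
      map′ (λ gf τ a≤τ τ+1+e≤b → gf {τ} (τ<b τ τ+1+e≤b) a≤τ τ+1+e≤b) (λ gf {τ} _ → gf τ)
           (allUpTo? (λ τ → (a ≤? τ) →-dec ((τ + suc e ≤? b) →-dec gap? τ)) b)
      where
        τ<b : ∀ τ → τ + suc e ≤ b → τ < b
        τ<b τ τ+1+e≤b = ≤-<-trans (m≤m+n τ e) (≤-trans (≤-reflexive (sym (+-suc τ e))) τ+1+e≤b)
        gap? : ∀ τ → Dec (∃[ r ] (TE u v r × τ < r × r ≤ τ + suc e))
        gap? τ = ∃∈? (λ r → (τ <? r) ×-dec (r ≤? τ + suc e)) (times 𝒢 u v)

    Linked? : ∀ u v t s → Dec (Linked u v t s)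
    Linked? u v t s = ∃∈? (λ s' → Near? s' t ×-dec GapFreeOn? u v (s' ⊓ s) (s' ⊔ s)) (times 𝒢 u v)

    EdgeOf? : ∀ x t u v s → Dec (EdgeOf x t u v s)
    EdgeOf? x t u v s = map′ (λ (l , r , h , k) → edgeOf l r h k) (λ m → left m , right m , timeEdge m , linked m)
                             (VertexOf? x t u ×-dec VertexOf? x t v ×-dec TE? u v s ×-dec Linked? u v t s)

    private
      edgesBetween : V → V → List (V × V × ℕ)
      edgesBetween u v = map (λ s → u , v , s) (times 𝒢 u v)

      edgesFrom : V → List (V × V × ℕ)
      edgesFrom u = concatMap (edgesBetween u) (allFin _)

    timeEdges : List (V × V × ℕ)
    timeEdges = concatMap edgesFrom (allFin _)

    ∈-timeEdges⁺ : ∀ {u v s} → TE u v s → (u , v , s) ∈ₗ timeEdges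
    ∈-timeEdges⁺ {u} {v} h =
      ∈-concatMap⁺ edgesFrom (lose (∈-allFin u)
        (∈-concatMap⁺ (edgesBetween u) (lose (∈-allFin v) (∈-map⁺ (λ s → u , v , s) h))))

    ∈-timeEdges⁻ : ∀ {u v s} → (u , v , s) ∈ₗ timeEdges → TE u v s
    ∈-timeEdges⁻ m with find (∈-concatMap⁻ edgesFrom {xs = allFin _} m)
    ... | u , _ , m' with find (∈-concatMap⁻ (edgesBetween u) {xs = allFin _} m')
    ... | v , _ , m'' with ∈-map⁻ (λ s → u , v , s) m''
    ... | _ , h , refl = h

    edgeTimes : V → ℕ → List ℕ
    edgeTimes x t = map (λ (_ , _ , s) → s) (filter (λ (u , v , s) → EdgeOf? x t u v s) timeEdges)

    ∈-edgeTimes⁺ : ∀ {x t u v s} → EdgeOf x t u v s → s ∈ₗ edgeTimes x t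
    ∈-edgeTimes⁺ {x} {t} m = ∈-map⁺ _ (∈-filter⁺ (λ (u , v , s) → EdgeOf? x t u v s) (∈-timeEdges⁺ (timeEdge m)) m)

    ∈-edgeTimes⁻ : ∀ {x t s} → s ∈ₗ edgeTimes x t → ∃[ u ] ∃[ v ] EdgeOf x t u v s
    ∈-edgeTimes⁻ {x} {t} m with ∈-map⁻ _ m
    ... | (u , v , _) , m' , refl = u , v , proj₂ (∈-filter⁻ (λ (u , v , s) → EdgeOf? x t u v s) {xs = timeEdges} m')

    -- Seeding with the anchor time t is harmless: when (x, t) is a time-edge, t is itself a time of the template.
    startOf endOf : V → ℕ → ℕ
    startOf x t = min t (edgeTimes x t)
    endOf   x t = max t (edgeTimes x t)

    startOf≤ : ∀ {x t u v s} → EdgeOf x t u v s → startOf x t ≤ s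
    startOf≤ {x} {t} m = All.lookup (min≤xs t (edgeTimes x t)) (∈-edgeTimes⁺ m)

    ≤endOf : ∀ {x t u v s} → EdgeOf x t u v s → s ≤ endOf x t
    ≤endOf {x} {t} m = All.lookup (xs≤max t (edgeTimes x t)) (∈-edgeTimes⁺ m)

    startOf≤anchor : ∀ x t → startOf x t ≤ t
    startOf≤anchor x t = min≤⊤ t (edgeTimes x t)

    anchor≤endOf : ∀ x t → t ≤ endOf x t
    anchor≤endOf x t = ⊥≤max t (edgeTimes x t)

    private
      TimeOfEdge : V → ℕ → ℕ → Set
      TimeOfEdge x t s = ∃[ u ] ∃[ v ] EdgeOf x t u v s

      timeOfEdge-everywhere : ∀ {x y t} → TE x y t → TimeOfEdge x t t × All (TimeOfEdge x t) (edgeTimes x t)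
      timeOfEdge-everywhere {x} {y} {t} h = (x , y , edgeOf-anchor h (near-refl t)) , All.tabulate ∈-edgeTimes⁻

    startOf-edgeOf : ∀ {x y t} → TE x y t → ∃[ u ] ∃[ v ] EdgeOf x t u v (startOf x t)
    startOf-edgeOf h = let (at-t , all) = timeOfEdge-everywhere h in argmin-all (λ s → s) at-t all

    endOf-edgeOf : ∀ {x y t} → TE x y t → ∃[ u ] ∃[ v ] EdgeOf x t u v (endOf x t)
    endOf-edgeOf h = let (at-t , all) = timeOfEdge-everywhere h in argmax-all (λ s → s) at-t all

    vertexSet : V → ℕ → Subset (n 𝒢)
    vertexSet x t = tabulate (λ z → does (VertexOf? x t z))

    ∈-vertexSet⁺ : ∀ {x t z} → VertexOf x t z → z ∈ vertexSet x t
    ∈-vertexSet⁺ {x} {t} {z} z∈ = lookup⇒[]= z _ (trans (lookup∘tabulate _ z) (dec-true (VertexOf? x t z) z∈))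

    ∈-vertexSet⁻ : ∀ {x t z} → z ∈ vertexSet x t → VertexOf x t z
    ∈-vertexSet⁻ {x} {t} {z} z∈ =
      toWitness (from T-≡ (trans (isYes≗does (VertexOf? x t z)) (trans (sym (lookup∘tabulate _ z)) ([]=⇒lookup z∈))))

    templateAt : V → ℕ → Template (n 𝒢)
    templateAt x t = template (vertexSet x t) (startOf x t) (endOf x t)

    sameTemplate⇒≡ : ∀ {x y t x' y' t'} → TE x y t → TE x' y' t' →
                     SameTemplate x t x' t' → templateAt x t ≡ templateAt x' t'
    sameTemplate⇒≡ {x} {y} {t} {x'} {y'} {t'} h h' E = template-cong
      (tabulate-cong (λ z → does-⇔ (vertices E z) (VertexOf? x t z) (VertexOf? x' t' z)))
      (≤-antisym (let (u , v , m) = startOf-edgeOf h' in startOf≤ (from (edges E u v _) m))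
                 (let (u , v , m) = startOf-edgeOf h  in startOf≤ (to   (edges E u v _) m)))
      (≤-antisym (let (u , v , m) = endOf-edgeOf h   in ≤endOf (to   (edges E u v _) m))
                 (let (u , v , m) = endOf-edgeOf h'  in ≤endOf (from (edges E u v _) m)))
      where
        template-cong : ∀ {X X' a a' b b'} → X ≡ X' → a ≡ a' → b ≡ b' → template {n 𝒢} X a b ≡ template X' a' b'
        template-cong refl refl refl = refl

    module _ (local : (L : List V) → length L ≤ 5 → LocalCluster (_∈ₗ L)) where

      SharedLocally : List V → V → ℕ → V → ℕ → Set₁
      SharedLocally W x t x' t' = ∀ {S} → (∀ {w} → w ∈ₗ W → S w) → (C : LocalCluster S) →
        let open LocalCluster C in ∃[ i ] (Member i x × InSpan i t × Member i x' × InSpan i t')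

      sharedLocally⇒sameTemplate : ∀ W {x t x' t'} → length W ≤ 3 → x ∈ₗ W → x' ∈ₗ W →
                                   SharedLocally W x t x' t' → SameTemplate x t x' t'
      sharedLocally⇒sameTemplate W {x} {t} {x'} {t'} |W|≤3 x∈W x'∈W shared = record
        { vertices = λ z → agree-vertex z (on (z ∷ []) (s≤s z≤n))
        ; edges    = λ u v s → agree-edge u v s (on (u ∷ v ∷ []) ≤-refl)
        }
        where
          on : (ys : List V) → length ys ≤ 2 → LocalCluster (_∈ₗ W ++ ys)
          on ys |ys|≤2 = local (W ++ ys) (subst (_≤ 5) (sym (length-++ W)) (+-mono-≤ |W|≤3 |ys|≤2))

          agree-vertex : ∀ z → LocalCluster (_∈ₗ W ++ z ∷ []) → VertexOf x t z ⇔ VertexOf x' t' z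
          agree-vertex z C with shared ∈-++⁺ˡ C
          ... | i , x∈i , t∈i , x'∈i , t'∈i =
            ⇔.trans (vertexOf⇔member (∈-++⁺ˡ x∈W) z∈ x∈i t∈i) (⇔.sym (vertexOf⇔member (∈-++⁺ˡ x'∈W) z∈ x'∈i t'∈i))
            where
              open Local C
              z∈ : z ∈ₗ W ++ z ∷ []
              z∈ = ∈-++⁺ʳ W (here refl)

          agree-edge : ∀ u v s → LocalCluster (_∈ₗ W ++ u ∷ v ∷ []) → EdgeOf x t u v s ⇔ EdgeOf x' t' u v s
          agree-edge u v s C with shared ∈-++⁺ˡ C
          ... | i , x∈i , t∈i , x'∈i , t'∈i =
            ⇔.trans (edgeOf⇔member (∈-++⁺ˡ x∈W) u∈ v∈ x∈i t∈i) (⇔.sym (edgeOf⇔member (∈-++⁺ˡ x'∈W) u∈ v∈ x'∈i t'∈i))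
            where
              open Local C
              u∈ : u ∈ₗ W ++ u ∷ v ∷ []
              u∈ = ∈-++⁺ʳ W (here refl)
              v∈ : v ∈ₗ W ++ u ∷ v ∷ []
              v∈ = ∈-++⁺ʳ W (there (here refl))

      anchor-edgeOf⇒sameTemplate : ∀ {x y t v s} → TE x y t → EdgeOf x t x v s → SameTemplate x t x s
      anchor-edgeOf⇒sameTemplate {x} {y} {t} {v} {s} h m =
        sharedLocally⇒sameTemplate (x ∷ y ∷ v ∷ []) ≤-refl (here refl) (here refl) shared
        where
          shared : SharedLocally (x ∷ y ∷ v ∷ []) x t x s
          shared W⊆S C =
            let (i , x∈i , _ , t∈i) = LocalCluster.covers C x y t (W⊆S (here refl)) (W⊆S (there (here refl))) h
                x∈W = W⊆S (here refl)
                (_ , _ , _ , s∈i) = to (Local.edgeOf⇔member C x∈W x∈W (W⊆S (there (there (here refl)))) x∈i t∈i) m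
            in i , x∈i , t∈i , x∈i , s∈i

      timeEdge⇒sameTemplate : ∀ {x u s} → TE x u s → SameTemplate x s u s
      timeEdge⇒sameTemplate {x} {u} {s} h =
        sharedLocally⇒sameTemplate (x ∷ u ∷ []) (n≤1+n 2) (here refl) (there (here refl)) shared
        where
          shared : SharedLocally (x ∷ u ∷ []) x s u s
          shared W⊆S C with LocalCluster.covers C x u s (W⊆S (here refl)) (W⊆S (there (here refl))) h
          ... | i , x∈i , u∈i , s∈i = i , x∈i , s∈i , u∈i , s∈i

      edgeOf⇒sameTemplate : ∀ {x y t u v s} → TE x y t → EdgeOf x t u v s → SameTemplate x t u s
      edgeOf⇒sameTemplate {x} {y} {t} {u} {v} {s} h m with u ≟ᶠ x | v ≟ᶠ x | left m
      ... | yes refl | _        | _ = anchor-edgeOf⇒sameTemplate h m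
      ... | no _     | yes refl | _ =
        sameTemplate-trans (anchor-edgeOf⇒sameTemplate h (edgeOf-sym m)) (timeEdge⇒sameTemplate (TE-sym (timeEdge m)))
      ... | no u≢x   | no _     | inj₁ u≡x = ⊥-elim (u≢x u≡x)
      ... | no _     | no _     | inj₂ (r , h' , r~t) =
        let xt≈xr = anchor-edgeOf⇒sameTemplate h (edgeOf-anchor h' r~t)
            xr≈ur = timeEdge⇒sameTemplate h'
            m' = to (edges xr≈ur u v s) (to (edges xt≈xr u v s) m)
        in sameTemplate-trans xt≈xr (sameTemplate-trans xr≈ur (anchor-edgeOf⇒sameTemplate (TE-sym h') m'))

      edgeOf-exists : ∀ {x y t u v} → TE x y t → VertexOf x t u → VertexOf x t v → u ≢ v → ∃[ r ] EdgeOf x t u v r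
      edgeOf-exists {x} {y} {t} {u} {v} h u∈ v∈ u≢v = go (local (x ∷ y ∷ u ∷ v ∷ []) (n≤1+n 4))
        where
          go : LocalCluster (_∈ₗ x ∷ y ∷ u ∷ v ∷ []) → ∃[ r ] EdgeOf x t u v r
          go C =
            let open LocalCluster C
                open Local C
                sx = here refl
                su = there (there (here refl))
                sv = there (there (there (here refl)))
                (i , x∈i , _ , t∈i) = covers x y t sx (there (here refl)) h
                u∈i = to (vertexOf⇔member sx su x∈i t∈i) u∈
                v∈i = to (vertexOf⇔member sx sv x∈i t∈i) v∈
                (r , h' , r∈i , _) = close-inSpan su sv u∈i v∈i u≢v t∈i
            in r , from (edgeOf⇔member sx su sv x∈i t∈i) (u∈i , v∈i , h' , r∈i)

      -- The local template containing a time-edge (pq, s) of the template anchored at (x, t)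
      -- cuts out exactly the uv-time-edges of that template.
      edgeOf⇒span : ∀ {x y t p q s u v} → TE x y t → EdgeOf x t p q s → VertexOf x t u → VertexOf x t v → u ≢ v →
                    ∃[ α ] ∃[ β ] (s ∈[ α , β ] × Span (EdgeOf x t u v) α β)
      edgeOf⇒span {x} {y} {t} {p} {q} {s} {u} {v} h m u∈ v∈ u≢v = go (local (p ∷ q ∷ u ∷ v ∷ []) (n≤1+n 4))
        where
          go : LocalCluster (_∈ₗ p ∷ q ∷ u ∷ v ∷ []) → ∃[ α ] ∃[ β ] (s ∈[ α , β ] × Span (EdgeOf x t u v) α β)
          go C =
            let open LocalCluster C
                open Local C
                sp = here refl
                su = there (there (here refl))
                sv = there (there (there (here refl)))
                E = edgeOf⇒sameTemplate h m
                (i , p∈i , _ , s∈i) = covers p q s sp (there (here refl)) (timeEdge m)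
                u∈i = to (vertexOf⇔member sp su p∈i s∈i) (to (vertices E u) u∈)
                v∈i = to (vertexOf⇔member sp sv p∈i s∈i) (to (vertices E v) v∈)
                edgeOf⇔ : ∀ r → EdgeOf x t u v r ⇔ (Member i u × Member i v × TE u v r × InSpan i r)
                edgeOf⇔ r = ⇔.trans (edges E u v r) (edgeOf⇔member sp su sv p∈i s∈i)
                windows : ∀ τ → start i ≤ τ → τ ≤ end i ∸ e → ∃[ r ] (EdgeOf x t u v r × τ ≤ r × r ≤ τ + e)
                windows τ α≤τ τ≤β∸e =
                  let (r , h' , r∈i , τ≤r , r≤τ+e) = window-inSpan su sv u∈i v∈i u≢v α≤τ τ≤β∸e
                  in r , from (edgeOf⇔ r) (u∈i , v∈i , h' , r∈i) , τ≤r , r≤τ+e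
            in start i , end i , s∈i ,
               record { bounds = λ m' → proj₂ (proj₂ (proj₂ (to (edgeOf⇔ _) m'))) ; windows = windows }

      edgeOf-windowDense : ∀ {x y t u v} → TE x y t → VertexOf x t u → VertexOf x t v → u ≢ v →
                           WindowDense (EdgeOf x t u v) (startOf x t) (endOf x t)
      edgeOf-windowDense {x} {y} {t} {u} {v} h u∈ v∈ u≢v =
        let (_ , _ , at-start) = startOf-edgeOf h
            (_ , _ , at-end)   = endOf-edgeOf h
            (_ , _ , (α≤a , _) , startSpan)  = edgeOf⇒span h at-start u∈ v∈ u≢v
            (_ , _ , (_ , b≤β') , endSpan) = edgeOf⇒span h at-end u∈ v∈ u≢v
        in spans⇒windowDense (EdgeOf? x t u v) (edgeOf-exists h u∈ v∈ u≢v) startOf≤ startSpan α≤a endSpan b≤β'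

      -- The only step that needs five vertices: the shared vertex z and both near time-edges.
      nearEdges⇒sameTemplate : ∀ {x y t x' y' t' z p q r p' q' r'} → TE x y t → TE x' y' t' →
                               VertexOf x t z → VertexOf x' t' z → EdgeOf x t p q r → EdgeOf x' t' p' q' r' →
                               Near r r' → SameTemplate x t x' t'
      nearEdges⇒sameTemplate {x} {y} {t} {x'} {y'} {t'} {z} {p} {q} {r} {p'} {q'} {r'} h h' z∈ z∈' m m' r~r' =
        go (local W ≤-refl)
        where
          W : List V
          W = z ∷ p ∷ q ∷ p' ∷ q' ∷ []
          sz : z ∈ₗ W
          sz = here refl
          sp : p ∈ₗ W
          sp = there (here refl)
          sq : q ∈ₗ W
          sq = there (there (here refl))
          sp' : p' ∈ₗ W
          sp' = there (there (there (here refl)))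
          sq' : q' ∈ₗ W
          sq' = there (there (there (there (here refl))))
          E : SameTemplate x t p r
          E = edgeOf⇒sameTemplate h m
          E' : SameTemplate x' t' p' r'
          E' = edgeOf⇒sameTemplate h' m'

          go : LocalCluster (_∈ₗ W) → SameTemplate x t x' t'
          go C with LocalCluster.covers C p q r sp sq (timeEdge m) | LocalCluster.covers C p' q' r' sp' sq' (timeEdge m')
          ... | i , p∈i , _ , r∈i | j , p'∈j , q'∈j , r'∈j
            with Local.template-unique C (to (Local.vertexOf⇔member C sp sz p∈i r∈i) (to (vertices E z) z∈))
                                         (to (Local.vertexOf⇔member C sp' sz p'∈j r'∈j) (to (vertices E' z) z∈'))
                                         r∈i r'∈j r~r'
          ... | refl = sameTemplate-trans E (sameTemplate-trans (edgeOf⇒sameTemplate (timeEdge m) pr~p'r') (sameTemplate-sym E'))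
            where
              pr~p'r' : EdgeOf p r p' q' r'
              pr~p'r' = from (Local.edgeOf⇔member C sp sp' sq' p∈i r∈i) (p'∈j , q'∈j , timeEdge m' , r'∈j)

      another-vertex : ∀ {x y t} z → TE x y t → ∃[ w ] (VertexOf x t w × z ≢ w)
      another-vertex {x} {y} {t} z h with z ≟ᶠ x
      ... | yes refl = y , inj₂ (t , h , near-refl t) , TE⇒≢ h
      ... | no z≢x   = x , inj₁ refl , z≢x

      private
        overlap⇒sameTemplate-≤ : ∀ {x y t x' y' t' z s s'} → TE x y t → TE x' y' t' →
                                 VertexOf x t z → VertexOf x' t' z → s ≤ endOf x t → startOf x' t' ≤ s' → Near s s' →
                                 startOf x t ≤ startOf x' t' → SameTemplate x t x' t'
        overlap⇒sameTemplate-≤ {x} {y} {t} {x'} {y'} {t'} {z} h h' z∈ z∈' s≤b a'≤s' s~s' a≤a'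
          with startOf-edgeOf h' | startOf x' t' ≤? endOf x t
        ... | _ , _ , m' | yes a'≤b =
          let (w , w∈ , z≢w) = another-vertex z h
              (r , m , r≈a') = windowDense⇒close (edgeOf-windowDense h z∈ w∈ z≢w) a≤a' a'≤b
          in nearEdges⇒sameTemplate h h' z∈ z∈' m m' (close⇒near r≈a')
        ... | _ , _ , m' | no a'≰b =
          let (_ , _ , m) = endOf-edgeOf h
          in nearEdges⇒sameTemplate h h' z∈ z∈' m m'
               (<-≤-trans (≰⇒> a'≰b) (m≤m+n _ Δ₂) , ≤-<-trans a'≤s' (<-≤-trans (proj₂ s~s') (+-monoˡ-≤ Δ₂ s≤b)))

      overlap⇒sameTemplate : ∀ {x y t x' y' t' z s s'} → TE x y t → TE x' y' t' → VertexOf x t z → VertexOf x' t' z →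
                             s ∈[ startOf x t , endOf x t ] → s' ∈[ startOf x' t' , endOf x' t' ] → Near s s' →
                             SameTemplate x t x' t'
      overlap⇒sameTemplate {x} {y} {t} {x'} {y'} {t'} h h' z∈ z∈' (a≤s , s≤b) (a'≤s' , s'≤b') s~s'
        with startOf x t ≤? startOf x' t'
      ... | yes a≤a' = overlap⇒sameTemplate-≤ h h' z∈ z∈' s≤b a'≤s' s~s' a≤a'
      ... | no a≰a' = sameTemplate-sym (overlap⇒sameTemplate-≤ h' h z∈' z∈ s'≤b' a≤s (near-sym s~s') (<⇒≤ (≰⇒> a≰a')))

      distinct⇒independent : ∀ {x y t x' y' t'} → TE x y t → TE x' y' t' → templateAt x t ≢ templateAt x' t' →
                             Independent Δ₂ (templateAt x t) (templateAt x' t')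
      distinct⇒independent {x} {y} {t} {x'} {y'} {t'} h h' T≢T'
        with any? (λ z → (z ∈? vertexSet x t) ×-dec (z ∈? vertexSet x' t'))
      ... | no disjoint = inj₁ (λ z z∈both → disjoint (z , z∈both))
      ... | yes (z , z∈ , z∈') = inj₂ far
        where
          far : ∀ s s' → s ∈[ startOf x t , endOf x t ] → s' ∈[ startOf x' t' , endOf x' t' ] → Δ₂ ≤ ∣ s - s' ∣
          far s s' s∈ s'∈ with Δ₂ ≤? ∣ s - s' ∣
          ... | yes Δ₂≤ = Δ₂≤
          ... | no Δ₂≰ = ⊥-elim (T≢T' (sameTemplate⇒≡ h h'
                           (overlap⇒sameTemplate h h' (∈-vertexSet⁻ z∈) (∈-vertexSet⁻ z∈') s∈ s'∈ (dist<⇒near (≰⇒> Δ₂≰)))))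

      templateAt-bounds : ∀ {x y t} → TE x y t → 1 ≤ startOf x t × startOf x t ≤ endOf x t × ≤Lifetime 𝒢 (endOf x t)
      templateAt-bounds {x} {y} {t} h =
        let (u , v , m) = startOf-edgeOf h
            (u' , v' , m') = endOf-edgeOf h
        in pos 𝒢 u v _ (timeEdge m) , ≤-trans (startOf≤anchor x t) (anchor≤endOf x t) , (u' , v' , _ , timeEdge m' , ≤-refl)

      templateAt-dense : ∀ {x y t u v} → TE x y t → u ∈ vertexSet x t → v ∈ vertexSet x t → u ≢ v →
                         IsEdge 𝒢 u v × Dense 𝒢 (suc e) u v (startOf x t) (endOf x t)
      templateAt-dense h u∈ v∈ u≢v =
        (λ no-times → let (r , m) = edgeOf-exists h (∈-vertexSet⁻ u∈) (∈-vertexSet⁻ v∈) u≢v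
                      in case subst (r ∈ₗ_) no-times (timeEdge m) of λ ()) ,
        from dense⇔windowDense (λ τ a≤τ τ≤ →
          let (r , m , window) = edgeOf-windowDense h (∈-vertexSet⁻ u∈) (∈-vertexSet⁻ v∈) u≢v τ a≤τ τ≤
          in r , timeEdge m , window)

      candidates : List (Template (n 𝒢))
      candidates = map (λ (x , _ , t) → templateAt x t) timeEdges

      templates : List (Template (n 𝒢))
      templates = deduplicate _≟ᵀ_ candidates

      ∈-templates⁺ : ∀ {x y t} → TE x y t → templateAt x t ∈ₗ templates
      ∈-templates⁺ h = ∈-deduplicate⁺ _≟ᵀ_ (∈-map⁺ (λ (x , _ , t) → templateAt x t) (∈-timeEdges⁺ h))

      ∈-templates⁻ : ∀ {T} → T ∈ₗ templates → ∃[ x ] ∃[ y ] ∃[ t ] (TE x y t × T ≡ templateAt x t)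
      ∈-templates⁻ T∈ with ∈-map⁻ (λ (x , _ , t) → templateAt x t) (∈-deduplicate⁻ _≟ᵀ_ _ T∈)
      ... | (x , y , t) , xyt∈ , refl = x , y , t , ∈-timeEdges⁻ xyt∈ , refl

      locallyCluster⇒cluster : IsCluster (suc e) Δ₂ 𝒢
      locallyCluster⇒cluster = length templates , family , independent , bounded , covered , dense
        where
          family : Fin (length templates) → Template (n 𝒢)
          family = lookup templates

          anchor : ∀ i → ∃[ x ] ∃[ y ] ∃[ t ] (TE x y t × family i ≡ templateAt x t)
          anchor i = ∈-templates⁻ (∈-lookup i)

          independent : ∀ i j → i ≢ j → Independent Δ₂ (family i) (family j)
          independent i j i≢j =
            let (_ , _ , _ , h , Tᵢ≡) = anchor i
                (_ , _ , _ , h' , Tⱼ≡) = anchor j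
                injective = lookup-injective (deduplicate-! _≟ᵀ_ candidates) i j
            in subst₂ (Independent Δ₂) (sym Tᵢ≡) (sym Tⱼ≡)
                 (distinct⇒independent h h' (λ T≡T' → i≢j (injective (trans Tᵢ≡ (trans T≡T' (sym Tⱼ≡))))))

          bounded : ∀ i → 1 ≤ a (family i) × a (family i) ≤ b (family i) × ≤Lifetime 𝒢 (b (family i))
          bounded i = let (_ , _ , _ , h , Tᵢ≡) = anchor i
                      in subst (λ T → 1 ≤ a T × a T ≤ b T × ≤Lifetime 𝒢 (b T)) (sym Tᵢ≡) (templateAt-bounds h)

          covered : ∀ x y t → TE x y t → ∃[ i ] (x ∈ X (family i) × y ∈ X (family i) × t ∈[ a (family i) , b (family i) ])
          covered x y t h =
            let T∈ = ∈-templates⁺ h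
            in Any.index T∈ , subst (λ T → x ∈ X T × y ∈ X T × t ∈[ a T , b T ]) (lookup-index T∈)
                 (∈-vertexSet⁺ (inj₁ refl) , ∈-vertexSet⁺ (inj₂ (t , h , near-refl t)) ,
                  startOf≤anchor x t , anchor≤endOf x t)

          dense : ∀ i u v → u ∈ X (family i) → v ∈ X (family i) → u ≢ v →
                  IsEdge 𝒢 u v × Dense 𝒢 (suc e) u v (a (family i)) (b (family i))
          dense i u v = let (_ , _ , _ , h , Tᵢ≡) = anchor i
                        in subst (λ T → u ∈ X T → v ∈ X T → u ≢ v → IsEdge 𝒢 u v × Dense 𝒢 (suc e) u v (a T) (b T))
                                 (sym Tᵢ≡) (templateAt-dense h)

lemma16 : (Δ₁ Δ₂ : ℕ) → 1 ≤ Δ₁ → Δ₁ < Δ₂ → (𝒢 : TemporalGraph) →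
    (∀ (m : ℕ) → m ≤ 5 → (f : Fin m → Fin (n 𝒢)) → (inj : Injective _≡_ _≡_ f) →
      IsCluster Δ₁ Δ₂ (induced 𝒢 f inj)) →
    IsCluster Δ₁ Δ₂ 𝒢
lemma16 zero    _  ()  _      _ _
lemma16 (suc e) Δ₂ _ 1+e<Δ₂ 𝒢 H = locallyCluster⇒cluster e Δ₂ 1+e<Δ₂ 𝒢 (localCluster e Δ₂ 1+e<Δ₂ 𝒢 H)
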